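{- Let $\ell > 2$ be an even integer. If $n$ is an even integer with $n > \frac{\ell^2+2\ell-4}{2}$, then the honeycomb toroidal graph $\mathrm{HTG}(2,n,\ell)$ is 2-spanning cyclable.
   Context: For integers $m\ge 1$, $\ell\ge 0$ and $n\ge 4$ with $n$ even and $m-\ell$ even, the honeycomb toroidal graph $\mathrm{HTG}(m,n,\ell)$ is the simple graph with vertex set $\{u_{i,j}: 0\le i\le m-1,\ 0\le j\le n-1\}$ (first subscript computed modulo $m$, second modulo $n$) whose edge set is the set of the following unordered pairs: $\{u_{i,j},u_{i,j+1}\}$ for all $i,j$ (vertical edges); $\{u_{i,j},u_{i+1,j}\}$ for all $0\le i\le m-2$ with $i+j$ odd (flat edges); and $\{u_{m-1,j},u_{0,j+\ell}\}$ for all $j$ having the same parity as $m$ (and $\ell$) (jump edges). A 2-factor of a graph is a spanning subgraph in which every vertex has valency 2. A graph $X$ is 2-spanning cyclable if for every pair of distinct vertices $u,v$ of $X$ there is a 2-factor of $X$ consisting of exactly two cycles such that $u$ and $v$ lie in different cycles. -}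

module Defs where

open import Data.Nat using (ℕ; zero; suc; _+_; _*_; _∸_; _<_; _≤_; NonZero)
open import Data.Nat.DivMod using (_%_)
open import Data.Fin using (Fin; toℕ)
open import Data.Product using (_×_; _,_; Σ; ∃)
open import Data.Sum using (_⊎_)
open import Data.List using (List; length; head; last; _∷_; [])
open import Data.Maybe using (just)
open import Data.List.Relation.Unary.Unique.Propositional using (Unique)
open import Data.List.Relation.Unary.Linked using (Linked)
open import Data.List.Membership.Propositional using (_∈_)
open import Relation.Binary.PropositionalEquality using (_≡_; _≢_)
open import Relation.Nullary using (¬_)

record Graph : Set₁ where
  field
    V   : Set
    Adj : V → V → Set
open Graph public

-- Directed versions of the three edge kinds of HTG(m,n,ℓ); vertex u_{i,j} is (i , j).
-- vertical: u_{i,j} -> u_{i,j+1}   (second index mod n)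
-- flat:     u_{i,j} -> u_{i+1,j}   for 0 ≤ i ≤ m-2, i+j odd
-- jump:     u_{m-1,j} -> u_{0,j+ℓ} for j ≡ m (mod 2)
data HTGEdge (m n ℓ : ℕ) .{{_ : NonZero n}} : Fin m × Fin n → Fin m × Fin n → Set where
  vertical : ∀ i j j' → toℕ j' ≡ (toℕ j + 1) % n → HTGEdge m n ℓ (i , j) (i , j')
  flat     : ∀ i i' j → toℕ i' ≡ toℕ i + 1 → (toℕ i + toℕ j) % 2 ≡ 1 →
             HTGEdge m n ℓ (i , j) (i' , j)
  jump     : ∀ i i' j j' → toℕ i ≡ m ∸ 1 → toℕ i' ≡ 0 → toℕ j % 2 ≡ m % 2 →
             toℕ j' ≡ (toℕ j + ℓ) % n → HTGEdge m n ℓ (i , j) (i' , j')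

HTG : (m n ℓ : ℕ) .{{_ : NonZero n}} → Graph
HTG m n ℓ = record
  { V   = Fin m × Fin n
  ; Adj = λ x y → HTGEdge m n ℓ x y ⊎ HTGEdge m n ℓ y x }

record IsCycle (G : Graph) (c : List (V G)) : Set where
  field
    long     : 3 ≤ length c
    distinct : Unique c
    path     : Linked (Adj G) c
    closing  : ∀ {a b} → head c ≡ just a → last c ≡ just b → Adj G b a

-- A 2-factor of G consisting of exactly two cycles: two vertex-disjoint cycles of G
-- which together contain every vertex (its edge set is the union of the cycles' edges).
record TwoCycleFactor (G : Graph) (c₁ c₂ : List (V G)) : Set where
  field
    cycle₁   : IsCycle G c₁
    cycle₂   : IsCycle G c₂
    disjoint : ∀ x → x ∈ c₁ → ¬ (x ∈ c₂)
    spanning : ∀ x → x ∈ c₁ ⊎ x ∈ c₂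

TwoSpanningCyclable : Graph → Set
TwoSpanningCyclable G =
  ∀ (u v : V G) → u ≢ v →
  Σ (List (V G)) λ c₁ → Σ (List (V G)) λ c₂ →
    TwoCycleFactor G c₁ c₂ × u ∈ c₁ × v ∈ c₂

-- Vertices in different rows are separated by the two rows, which are vertical
-- cycles. For two vertices of the same row write ℓ = 2t + 4. For even s the
-- columns s+1, …, s+ℓ-1 of both rows form a ladder cycle, and if
-- n - 2ℓ = aℓ + b(ℓ+2) the remaining vertices form one cycle made of a zigzag
-- blocks of width ℓ and b blocks of width ℓ+2 chained by jump edges. As ℓ/2 and
-- ℓ/2 + 1 are consecutive, such a and b exist once n/2 - ℓ ≥ (ℓ/2)(ℓ/2 - 1),
-- which is the bound on n. Finally, after swapping x and y if needed, either x
-- is odd and lies on two ladders sharing only column x, or x and y are both even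
-- and x lies on two ladders sharing only x and its two odd neighbours; either
-- way one of these ladders misses y.
module Submission where

open import Defs
open import Data.Nat using (ℕ; zero; suc; pred; _+_; _*_; _∸_; _<_; _≤_; z≤n; s≤s; NonZero)
open import Data.Nat.Properties
open import Data.Nat.DivMod
open import Data.Nat.Divisibility using (_∣_; n∣m*n; ∣m+n∣m⇒∣n; n∣m⇒m%n≡0; m%n≡0⇒n∣m)
open import Data.Fin using (Fin; toℕ) renaming (zero to fz; suc to fs)
open import Data.Fin.Properties as Fin using (toℕ-fromℕ<; toℕ-injective; toℕ<n)
open import Data.Product using (_×_; _,_; Σ; proj₂)
open import Data.Sum using (_⊎_; inj₁; inj₂) renaming (swap to ⊎-swap)
open import Data.List using (List; []; _∷_; _++_; length; head; last)
open import Data.List.Properties using (++-assoc)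
open import Data.Maybe using (just)
open import Data.Maybe.Properties using (just-injective)
open import Data.Empty using (⊥; ⊥-elim)
open import Relation.Nullary using (¬_; yes; no)
open import Function using (_∘_)
open import Data.Nat.Tactic.RingSolver using (solve-∀)
open import Relation.Binary.PropositionalEquality
open import Data.List.Relation.Unary.All as All using ([]; _∷_)
import Data.List.Relation.Unary.All.Properties as All
open import Data.List.Relation.Unary.Linked using (Linked; [-]; _∷_)
open import Data.List.Relation.Unary.Unique.Propositional using (Unique; []; _∷_)
import Data.List.Relation.Unary.Unique.Propositional.Properties as Unique
open import Data.List.Relation.Binary.Disjoint.Propositional using (Disjoint)
open import Data.List.Relation.Unary.Any using (here; there)
open import Data.List.Membership.Propositional using (_∈_)
open import Data.List.Membership.Propositional.Properties using (∈-++⁻; ∈-++⁺ˡ; ∈-++⁺ʳ)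
open import Data.List.Relation.Binary.Permutation.Propositional
  using (_↭_; ↭-refl; ↭-sym; ↭-trans; prep; ↭⇒↭ₛ; module PermutationReasoning)
open import Data.List.Relation.Binary.Permutation.Propositional.Properties
  using (∈-resp-↭; ++-comm; ++⁺; ++⁺ˡ; ++-commutativeMonoid)
import Data.List.Relation.Binary.Permutation.Setoid.Properties as Setoid↭
import Data.List.Membership.DecPropositional as DecMembership
open import Data.Product.Properties using (≡-dec)
import Algebra.Solver.CommutativeMonoid

-- Arithmetic

Even Odd : ℕ → Set
Even c = c % 2 ≡ 0
Odd  c = c % 2 ≡ 1

%2-distrib-+ : ∀ a b {i j} → a % 2 ≡ i → b % 2 ≡ j → (a + b) % 2 ≡ (i + j) % 2
%2-distrib-+ a b p q = trans (%-distribˡ-+ a b 2) (cong₂ (λ x y → (x + y) % 2) p q)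

even+even⇒even : ∀ a b → Even a → Even b → Even (a + b)
even+even⇒even a b = %2-distrib-+ a b

odd+even⇒odd : ∀ a b → Odd a → Even b → Odd (a + b)
odd+even⇒odd a b = %2-distrib-+ a b

even+odd⇒odd : ∀ a b → Even a → Odd b → Odd (a + b)
even+odd⇒odd a b = %2-distrib-+ a b

odd+odd⇒even : ∀ a b → Odd a → Odd b → Even (a + b)
odd+odd⇒even a b = %2-distrib-+ a b

m*even⇒even : ∀ a b → Even b → Even (a * b)
m*even⇒even a b e = begin
  (a * b) % 2              ≡⟨ %-distribˡ-* a b 2 ⟩
  (a % 2 * (b % 2)) % 2    ≡⟨ cong (λ r → (a % 2 * r) % 2) e ⟩
  (a % 2 * 0) % 2          ≡⟨ cong (_% 2) (*-zeroʳ (a % 2)) ⟩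
  0                        ∎
  where open ≡-Reasoning

odd-suc : ∀ c → Even c → Odd (suc c)
odd-suc c = odd+even⇒odd 1 c refl

even-double : ∀ t → Even (t + t)
even-double zero    = refl
even-double (suc t) rewrite +-suc t t = even-double t

even⇒double : ∀ m → Even m → Σ ℕ λ h → m ≡ h + h
even⇒double zero          _ = 0 , refl
even⇒double (suc (suc m)) e with h , refl ← even⇒double m e = suc h , cong suc (sym (+-suc h h))

even⊎odd : ∀ a → Even a ⊎ Odd a
even⊎odd a with a % 2 | m%n<n a 2
... | 0           | _ = inj₁ refl
... | 1           | _ = inj₂ refl
... | suc (suc _) | s≤s (s≤s ())

even-cancelʳ : ∀ a b → Even (a + b) → Even b → Even a
even-cancelʳ a b h e with even⊎odd a
... | inj₁ ea = ea
... | inj₂ oa with trans (sym (odd+even⇒odd a b oa e)) h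
...   | ()

odd-cancelʳ : ∀ a b → Odd (a + b) → Odd b → Even a
odd-cancelʳ a b h o with even⊎odd a
... | inj₁ ea = ea
... | inj₂ oa with trans (sym (odd+odd⇒even a b oa o)) h
...   | ()

even⇒≡4+double : ∀ ℓ → Even ℓ → 2 < ℓ → Σ ℕ λ t → ℓ ≡ 4 + (t + t)
even⇒≡4+double (suc (suc (suc (suc ℓ)))) even _ with t , refl ← even⇒double ℓ even = t , refl
even⇒≡4+double (suc (suc (suc zero))) () _
even⇒≡4+double (suc (suc zero)) _ (s≤s (s≤s ()))

odd⇒suc-even : ∀ m → Odd m → Σ ℕ λ s → suc s ≡ m × Even s
odd⇒suc-even (suc s) odd = s , refl , odd-cancelʳ s 1 (subst Odd (+-comm 1 s) odd) refl


module _ {n : ℕ} .{{_ : NonZero n}} where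

  [m%n+o]%n≡[m+o]%n : ∀ m o → (m % n + o) % n ≡ (m + o) % n
  [m%n+o]%n≡[m+o]%n m o = begin
    (m % n + o) % n           ≡⟨ %-distribˡ-+ (m % n) o n ⟩
    (m % n % n + o % n) % n   ≡⟨ cong (λ r → (r + o % n) % n) (m%n%n≡m%n m n) ⟩
    (m % n + o % n) % n       ≡⟨ %-distribˡ-+ m o n ⟨
    (m + o) % n               ∎
    where open ≡-Reasoning

  [m+o]%n≡m%n⇒o≡0 : ∀ m {o} → o < n → (m + o) % n ≡ m % n → o ≡ 0
  [m+o]%n≡m%n⇒o≡0 m {o} o<n h = begin
    o      ≡⟨ m<n⇒m%n≡m o<n ⟨
    o % n  ≡⟨ n∣m⇒m%n≡0 o n (∣m+n∣m⇒∣n (subst (n ∣_) quotients (n∣m*n A)) (n∣m*n B)) ⟩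
    0      ∎
    where
    open ≡-Reasoning
    A = (m + o) / n
    B = m / n
    quotients : A * n ≡ B * n + o
    quotients = +-cancelˡ-≡ (m % n) _ _ (begin
      m % n + A * n        ≡⟨ cong (_+ A * n) h ⟨
      (m + o) % n + A * n  ≡⟨ m≡m%n+[m/n]*n (m + o) n ⟨
      m + o                ≡⟨ cong (_+ o) (m≡m%n+[m/n]*n m n) ⟩
      m % n + B * n + o    ≡⟨ +-assoc (m % n) (B * n) o ⟩
      m % n + (B * n + o)  ∎)

  private
    ≤-injective : ∀ m {o p} → o ≤ p → p < n → (m + o) % n ≡ (m + p) % n → o ≡ p
    ≤-injective m {o} o≤p p<n h with k , refl ← m≤n⇒∃[o]m+o≡n o≤p =
      sym (trans (cong (o +_) k≡0) (+-identityʳ o))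
      where
      k≡0 : k ≡ 0
      k≡0 = [m+o]%n≡m%n⇒o≡0 (m + o) (≤-<-trans (m≤n+m k o) p<n)
              (trans (cong (_% n) (+-assoc m o k)) (sym h))

  [m+o]%n≡[m+p]%n⇒o≡p : ∀ m {o p} → o < n → p < n → (m + o) % n ≡ (m + p) % n → o ≡ p
  [m+o]%n≡[m+p]%n⇒o≡p m {o} {p} o<n p<n h with ≤-total o p
  ... | inj₁ o≤p = ≤-injective m o≤p p<n h
  ... | inj₂ p≤o = sym (≤-injective m p≤o o<n (sym h))

-- Write d + (k+1)k = q(k+1) + r with r ≤ k ≤ q; it is then (q-r)(k+1) + r(k+2).
consecutive-combination : ∀ k d → Σ ℕ λ a → Σ ℕ λ b → a * suc k + b * suc (suc k) ≡ d + suc k * k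
consecutive-combination k d = q ∸ r , r , (begin
  (q ∸ r) * suc k + r * suc (suc k)  ≡⟨ cong ((q ∸ r) * suc k +_) (*-suc r (suc k)) ⟩
  (q ∸ r) * suc k + (r + r * suc k)  ≡⟨ regroup ((q ∸ r) * suc k) r (r * suc k) ⟩
  ((q ∸ r) * suc k + r * suc k) + r  ≡⟨ cong (_+ r) (*-distribʳ-+ (suc k) (q ∸ r) r) ⟨
  (q ∸ r + r) * suc k + r            ≡⟨ cong (λ c → c * suc k + r) (m∸n+n≡m r≤q) ⟩
  q * suc k + r                      ≡⟨ +-comm (q * suc k) r ⟩
  r + q * suc k                      ≡⟨ m≡m%n+[m/n]*n N (suc k) ⟨
  N                                  ∎)
  where
  open ≡-Reasoning
  N = d + suc k * k
  q = N / suc k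
  r = N % suc k
  r≤q : r ≤ q
  r≤q = ≤-trans (≤-pred (m%n<n N (suc k)))
    (subst (_≤ q) (m*n/n≡m k (suc k))
      (/-monoˡ-≤ (suc k) (subst (_≤ N) (*-comm (suc k) k) (m≤n+m (suc k * k) d))))
  regroup : ∀ x y z → x + (y + z) ≡ (x + z) + y
  regroup = solve-∀

-- Walks and two-cycle factors

Unique-++⁻ : ∀ {X : Set} xs {ys : List X} → Unique (xs ++ ys) → Unique xs × Unique ys × Disjoint xs ys
Unique-++⁻ []       u          = [] , u , λ ()
Unique-++⁻ (x ∷ xs) (x∉ ∷ u) with Unique-++⁻ xs u
... | uxs , uys , xs#ys = All.++⁻ˡ xs x∉ ∷ uxs , uys , disjoint
  where
  disjoint : Disjoint (x ∷ xs) _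
  disjoint (here refl , v∈ys) = All.lookup (All.++⁻ʳ xs x∉) v∈ys refl
  disjoint (there v∈xs , v∈ys) = xs#ys (v∈xs , v∈ys)

Unique-resp-↭ : ∀ {X : Set} {xs ys : List X} → xs ↭ ys → Unique xs → Unique ys
Unique-resp-↭ {X} p = Setoid↭.Unique-resp-↭ (setoid X) (↭⇒↭ₛ p)

data Walk (G : Graph) : V G → List (V G) → V G → Set where
  [_] : ∀ x → Walk G x (x ∷ []) x
  _◅_ : ∀ {x y L z} → Adj G x y → Walk G y L z → Walk G x (x ∷ L) z

infixr 5 _◅_

module _ {G : Graph} where

  infixr 5 _++ʷ_ _++⟨_⟩_

  _++ʷ_ : ∀ {a L z L′ w} → Walk G a L z → Walk G z (z ∷ L′) w → Walk G a (L ++ L′) w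
  [ _ ]   ++ʷ q = q
  (e ◅ p) ++ʷ q = e ◅ (p ++ʷ q)

  _++⟨_⟩_ : ∀ {a L z b L′ w} → Walk G a L z → Adj G z b → Walk G b L′ w → Walk G a (L ++ L′) w
  p ++⟨ e ⟩ q = p ++ʷ (e ◅ q)

  Walk⇒Linked : ∀ {x L z} → Walk G x L z → Linked (Adj G) L
  Walk⇒Linked [ _ ]           = [-]
  Walk⇒Linked (e ◅ [ _ ])     = e ∷ [-]
  Walk⇒Linked (e ◅ e′ ◅ p)    = e ∷ Walk⇒Linked (e′ ◅ p)

  Walk-head : ∀ {x L z} → Walk G x L z → head L ≡ just x
  Walk-head [ _ ]   = refl
  Walk-head (_ ◅ _) = refl

  Walk-last : ∀ {x L z} → Walk G x L z → last L ≡ just z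
  Walk-last [ _ ]        = refl
  Walk-last (_ ◅ [ _ ])  = refl
  Walk-last (_ ◅ e ◅ p)  = Walk-last (e ◅ p)

  closedWalk⇒IsCycle : ∀ {x L z} → Walk G x L z → Adj G z x → 3 ≤ length L → Unique L → IsCycle G L
  closedWalk⇒IsCycle p zx len u = record
    { long     = len
    ; distinct = u
    ; path     = Walk⇒Linked p
    ; closing  = λ h l → subst₂ (Adj G)
        (just-injective (trans (sym (Walk-last p)) l))
        (just-injective (trans (sym (Walk-head p)) h)) zx
    }

  TwoCycleFactor-swap : ∀ {c₁ c₂} → TwoCycleFactor G c₁ c₂ → TwoCycleFactor G c₂ c₁
  TwoCycleFactor-swap F = record
    { cycle₁   = cycle₂
    ; cycle₂   = cycle₁
    ; disjoint = λ x x∈c₂ x∈c₁ → disjoint x x∈c₁ x∈c₂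
    ; spanning = λ x → ⊎-swap (spanning x)
    }
    where open TwoCycleFactor F

  Separating : V G → V G → Set
  Separating v w = Σ (List (V G)) λ c₁ → Σ (List (V G)) λ c₂ → TwoCycleFactor G c₁ c₂ × v ∈ c₁ × w ∈ c₂

  Separating-swap : ∀ {v w} → Separating v w → Separating w v
  Separating-swap (c₁ , c₂ , F , v∈ , w∈) = c₂ , c₁ , TwoCycleFactor-swap F , w∈ , v∈

  partition⇒TwoCycleFactor :
    ∀ {x₁ z₁ c₁ x₂ z₂ c₂ vs} →
    Walk G x₁ c₁ z₁ → Adj G z₁ x₁ → 3 ≤ length c₁ →
    Walk G x₂ c₂ z₂ → Adj G z₂ x₂ → 3 ≤ length c₂ →
    c₁ ++ c₂ ↭ vs → Unique vs → (∀ v → v ∈ vs) → TwoCycleFactor G c₁ c₂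
  partition⇒TwoCycleFactor {c₁ = c₁} p₁ e₁ len₁ p₂ e₂ len₂ perm uvs all∈
    with Unique-++⁻ c₁ (Unique-resp-↭ (↭-sym perm) uvs)
  ... | u₁ , u₂ , c₁#c₂ = record
    { cycle₁   = closedWalk⇒IsCycle p₁ e₁ len₁ u₁
    ; cycle₂   = closedWalk⇒IsCycle p₂ e₂ len₂ u₂
    ; disjoint = λ v v∈c₁ v∈c₂ → c₁#c₂ (v∈c₁ , v∈c₂)
    ; spanning = λ v → ∈-++⁻ c₁ (∈-resp-↭ (↭-sym perm) (all∈ v))
    }

-- The rows of HTG(2,n,ℓ)

r₀ r₁ : Fin 2
r₀ = fz
r₁ = fs fz

module Rows {n : ℕ} .{{_ : NonZero n}} (n-even : Even n) (ℓ : ℕ) where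

  G : Graph
  G = HTG 2 n ℓ

  Vertex : Set
  Vertex = V G

  infix 4 _~_
  _~_ : Vertex → Vertex → Set
  _~_ = Adj G

  u : Fin 2 → ℕ → Vertex
  u r c = r , c mod n

  toℕ-mod : ∀ c → toℕ (c mod n) ≡ c % n
  toℕ-mod c = toℕ-fromℕ< (m%n<n c n)

  u-cong : ∀ r {c d} → c % n ≡ d % n → u r c ≡ u r d
  u-cong r {c} {d} e = cong (r ,_) (toℕ-injective (trans (toℕ-mod c) (trans e (sym (toℕ-mod d)))))

  u-+n : ∀ r c → u r (c + n) ≡ u r c
  u-+n r c = u-cong r ([m+n]%n≡m%n c n)

  u-≡ : ∀ r c (x : Fin n) → c % n ≡ toℕ x → u r c ≡ (r , x)
  u-≡ r c x eq = cong (r ,_) (toℕ-injective (trans (toℕ-mod c) eq))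

  u-toℕ : ∀ r (x : Fin n) → u r (toℕ x) ≡ (r , x)
  u-toℕ r x = u-≡ r (toℕ x) x (m<n⇒m%n≡m (toℕ<n x))

  toℕ+n%n : ∀ (x : Fin n) → (toℕ x + n) % n ≡ toℕ x
  toℕ+n%n x = trans ([m+n]%n≡m%n (toℕ x) n) (m<n⇒m%n≡m (toℕ<n x))

  u-column : ∀ {r r′ c d} → u r c ≡ u r′ d → c % n ≡ d % n
  u-column {c = c} {d} eq = trans (sym (toℕ-mod c)) (trans (cong (toℕ ∘ proj₂) eq) (toℕ-mod d))

  [m%n]%2≡m%2 : ∀ c → c % n % 2 ≡ c % 2
  [m%n]%2≡m%2 c = m∣n⇒o%n%m≡o%m 2 n c (m%n≡0⇒n∣m n 2 n-even)

  ~-sym : ∀ {x y} → x ~ y → y ~ x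
  ~-sym (inj₁ e) = inj₂ e
  ~-sym (inj₂ e) = inj₁ e

  vertical-edge : ∀ r c → u r c ~ u r (suc c)
  vertical-edge r c = inj₁ (vertical r (c mod n) (suc c mod n) (begin
    toℕ (suc c mod n)        ≡⟨ toℕ-mod (suc c) ⟩
    suc c % n                ≡⟨ cong (_% n) (+-comm 1 c) ⟩
    (c + 1) % n              ≡⟨ [m%n+o]%n≡[m+o]%n c 1 ⟨
    (c % n + 1) % n          ≡⟨ cong (λ d → (d + 1) % n) (toℕ-mod c) ⟨
    (toℕ (c mod n) + 1) % n  ∎))
    where open ≡-Reasoning

  flat-edge : ∀ c → Odd c → u r₀ c ~ u r₁ c
  flat-edge c odd = inj₁ (flat r₀ r₁ (c mod n) refl
    (trans (cong (_% 2) (toℕ-mod c)) (trans ([m%n]%2≡m%2 c) odd)))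

  jump-edge : ∀ c → Even c → u r₁ c ~ u r₀ (c + ℓ)
  jump-edge c even = inj₁ (jump r₁ r₀ (c mod n) ((c + ℓ) mod n) refl refl
    (trans (cong (_% 2) (toℕ-mod c)) (trans ([m%n]%2≡m%2 c) even))
    (trans (toℕ-mod (c + ℓ))
      (sym (trans (cong (λ d → (d + ℓ) % n) (toℕ-mod c)) ([m%n+o]%n≡[m+o]%n c ℓ)))))

  up : Fin 2 → ℕ → ℕ → List Vertex
  up r c zero    = []
  up r c (suc k) = u r c ∷ up r (suc c) k

  down : Fin 2 → ℕ → ℕ → List Vertex
  down r c zero    = []
  down r c (suc k) = u r (c + k) ∷ down r c k

  up-walk : ∀ r c k → Walk G (u r c) (up r c (suc k)) (u r (c + k))
  up-walk r c zero    rewrite +-identityʳ c = [ _ ]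
  up-walk r c (suc k) rewrite +-suc c k     = vertical-edge r c ◅ up-walk r (suc c) k

  down-walk : ∀ r c k → Walk G (u r (c + k)) (down r c (suc k)) (u r c)
  down-walk r c zero rewrite +-identityʳ c = [ _ ]
  down-walk r c (suc k) =
    subst (λ d → Walk G (u r d) (u r d ∷ down r c (suc k)) (u r c)) (sym (+-suc c k))
      (~-sym (vertical-edge r (c + k)) ◅ down-walk r c k)

  up-++ : ∀ r c k₁ k₂ → up r c (k₁ + k₂) ≡ up r c k₁ ++ up r (c + k₁) k₂
  up-++ r c zero     k₂ = cong (λ d → up r d k₂) (sym (+-identityʳ c))
  up-++ r c (suc k₁) k₂ = cong (u r c ∷_)
    (trans (up-++ r (suc c) k₁ k₂) (cong (λ d → up r (suc c) k₁ ++ up r d k₂) (sym (+-suc c k₁))))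

  up-snoc : ∀ r c k → up r c (suc k) ≡ up r c k ++ u r (c + k) ∷ []
  up-snoc r c k = trans (cong (up r c) (+-comm 1 k)) (up-++ r c k 1)

  up-++₄ : ∀ r c k₁ k₂ k₃ k₄ {c₂ c₃ c₄} → c + k₁ ≡ c₂ → c₂ + k₂ ≡ c₃ → c₃ + k₃ ≡ c₄ →
    up r c (k₁ + (k₂ + (k₃ + k₄))) ≡ up r c k₁ ++ (up r c₂ k₂ ++ (up r c₃ k₃ ++ up r c₄ k₄))
  up-++₄ r c k₁ k₂ k₃ k₄ refl refl refl = begin
    up r c (k₁ + (k₂ + (k₃ + k₄)))
      ≡⟨ up-++ r c k₁ _ ⟩
    up r c k₁ ++ up r (c + k₁) (k₂ + (k₃ + k₄))
      ≡⟨ cong (up r c k₁ ++_) (up-++ r (c + k₁) k₂ _) ⟩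
    up r c k₁ ++ (up r (c + k₁) k₂ ++ up r (c + k₁ + k₂) (k₃ + k₄))
      ≡⟨ cong (λ L → up r c k₁ ++ (up r (c + k₁) k₂ ++ L)) (up-++ r (c + k₁ + k₂) k₃ k₄) ⟩
    up r c k₁ ++ (up r (c + k₁) k₂ ++ (up r (c + k₁ + k₂) k₃ ++ up r (c + k₁ + k₂ + k₃) k₄))
      ∎
    where open ≡-Reasoning

  down↭up : ∀ r c k → down r c k ↭ up r c k
  down↭up r c zero    = ↭-refl
  down↭up r c (suc k) = begin
    u r (c + k) ∷ down r c k      ↭⟨ prep _ (down↭up r c k) ⟩
    (u r (c + k) ∷ []) ++ up r c k ↭⟨ ++-comm (u r (c + k) ∷ []) (up r c k) ⟩
    up r c k ++ u r (c + k) ∷ []   ≡⟨ up-snoc r c k ⟨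
    up r c (suc k)                 ∎
    where open PermutationReasoning

  up-rotate : ∀ r c → up r (suc c) n ↭ up r c n
  up-rotate r c = subst (λ k → up r (suc c) k ↭ up r c k) (suc-pred n) (begin
    up r (suc c) (suc (pred n))              ≡⟨ up-snoc r (suc c) (pred n) ⟩
    up r (suc c) (pred n) ++ last′ ∷ []      ↭⟨ ++-comm (up r (suc c) (pred n)) _ ⟩
    last′ ∷ up r (suc c) (pred n)            ≡⟨ cong (_∷ up r (suc c) (pred n)) last′≡first ⟩
    u r c ∷ up r (suc c) (pred n)            ∎)
    where
    open PermutationReasoning
    last′ = u r (suc c + pred n)
    last′≡first : last′ ≡ u r c
    last′≡first = trans (cong (u r) (trans (sym (+-suc c (pred n))) (cong (c +_) (suc-pred n)))) (u-+n r c)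

  up↭row : ∀ r c → up r c n ↭ up r 0 n
  up↭row r zero    = ↭-refl
  up↭row r (suc c) = ↭-trans (up-rotate r c) (up↭row r c)

  length-up : ∀ r c k → length (up r c k) ≡ k
  length-up r c zero    = refl
  length-up r c (suc k) = cong suc (length-up r (suc c) k)

  ∈-up⁻ : ∀ {x} r c k → x ∈ up r c k → Σ ℕ λ e → e < k × x ≡ u r (c + e)
  ∈-up⁻ r c (suc k) (here refl) = 0 , s≤s z≤n , cong (u r) (sym (+-identityʳ c))
  ∈-up⁻ r c (suc k) (there x∈) with ∈-up⁻ r (suc c) k x∈
  ... | e , e<k , refl = suc e , s≤s e<k , cong (u r) (sym (+-suc c e))

  ∈-up⇒column : ∀ {r x} r′ c k → (r , x) ∈ up r′ c k → Σ ℕ λ e → e < k × toℕ x ≡ (c + e) % n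
  ∈-up⇒column r′ c k x∈ with ∈-up⁻ r′ c k x∈
  ... | e , e<k , eq = e , e<k , trans (cong (toℕ ∘ proj₂) eq) (toℕ-mod (c + e))

  ∈-up⁺ : ∀ r c k {e} → e < k → u r (c + e) ∈ up r c k
  ∈-up⁺ r c (suc k) {zero}  _         = here (cong (u r) (+-identityʳ c))
  ∈-up⁺ r c (suc k) {suc e} (s≤s e<k) =
    there (subst (_∈ up r (suc c) k) (cong (u r) (sym (+-suc c e))) (∈-up⁺ r (suc c) k e<k))

  up-unique : ∀ r c k → c + k ≤ n → Unique (up r c k)
  up-unique r c zero    _  = []
  up-unique r c (suc k) le = All.tabulate fresh ∷ up-unique r (suc c) k le′
    where
    le′ : suc c + k ≤ n
    le′ = subst (_≤ n) (+-suc c k) le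
    fresh : ∀ {y} → y ∈ up r (suc c) k → u r c ≢ y
    fresh y∈ eq with ∈-up⁻ r (suc c) k y∈
    ... | e , e<k , refl = m≢1+m+n c (begin
      c                ≡⟨ m<n⇒m%n≡m (≤-<-trans (m≤m+n c e) (<-trans (n<1+n (c + e)) lt)) ⟨
      c % n            ≡⟨ u-column eq ⟩
      suc (c + e) % n  ≡⟨ m<n⇒m%n≡m lt ⟩
      suc (c + e)      ∎)
      where
      open ≡-Reasoning
      lt : suc c + e < n
      lt = <-≤-trans (+-monoʳ-< (suc c) e<k) le′

  rows-disjoint : ∀ c k c′ k′ → Disjoint (up r₀ c k) (up r₁ c′ k′)
  rows-disjoint c k c′ k′ (x∈ , x∈′) with ∈-up⁻ r₀ c k x∈ | ∈-up⁻ r₁ c′ k′ x∈′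
  ... | _ , _ , refl | _ , _ , ()

  vertices : List Vertex
  vertices = up r₀ 0 n ++ up r₁ 0 n

  vertices-unique : Unique vertices
  vertices-unique =
    Unique.++⁺ (up-unique r₀ 0 n ≤-refl) (up-unique r₁ 0 n ≤-refl) (rows-disjoint 0 n 0 n)

  ∈-row : ∀ r (x : Fin n) → (r , x) ∈ up r 0 n
  ∈-row r x = subst (_∈ up r 0 n) (u-toℕ r x) (∈-up⁺ r 0 n (toℕ<n x))

  ∈-vertices : ∀ v → v ∈ vertices
  ∈-vertices (fz    , x) = ∈-++⁺ˡ (∈-row r₀ x)
  ∈-vertices (fs fz , x) = ∈-++⁺ʳ (up r₀ 0 n) (∈-row r₁ x)

  row-walk : ∀ r → Walk G (u r 0) (up r 0 n) (u r (pred n))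
  row-walk r =
    subst (λ k → Walk G (u r 0) (up r 0 k) (u r (pred n))) (suc-pred n) (up-walk r 0 (pred n))

  row-closing : ∀ r → u r (pred n) ~ u r 0
  row-closing r =
    subst (u r (pred n) ~_) (trans (cong (u r) (suc-pred n)) (u-+n r 0)) (vertical-edge r (pred n))

  rows-TwoCycleFactor : 3 ≤ n → TwoCycleFactor G (up r₀ 0 n) (up r₁ 0 n)
  rows-TwoCycleFactor 3≤n = partition⇒TwoCycleFactor
    (row-walk r₀) (row-closing r₀) (subst (3 ≤_) (sym (length-up r₀ 0 n)) 3≤n)
    (row-walk r₁) (row-closing r₁) (subst (3 ≤_) (sym (length-up r₁ 0 n)) 3≤n)
    ↭-refl vertices-unique ∈-vertices

-- Ladders in HTG(2,n,2t+4)

module Ladder {n : ℕ} .{{_ : NonZero n}} (n-even : Even n) (t : ℕ) where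

  ℓ∸2 ℓ∸1 ℓ ℓ+2 : ℕ
  ℓ∸2 = suc (suc (t + t))
  ℓ∸1 = suc ℓ∸2
  ℓ   = suc ℓ∸1
  ℓ+2 = suc (suc ℓ)

  open Rows n-even ℓ public

  even-ℓ∸2 : Even ℓ∸2
  even-ℓ∸2 = even-double t

  odd-ℓ∸1 : Odd ℓ∸1
  odd-ℓ∸1 = odd+even⇒odd 1 (t + t) refl (even-double t)

  even-ℓ : Even ℓ
  even-ℓ = even-double t

  even-ℓ+2 : Even ℓ+2
  even-ℓ+2 = even-double t

  -- For even s both end columns are odd, so flat edges close the two runs into a cycle.
  ladder : ℕ → List Vertex
  ladder s = up r₀ (suc s) ℓ∸1 ++ down r₁ (suc s) ℓ∸1

  ladder-walk : ∀ s → Even s → Walk G (u r₀ (suc s)) (ladder s) (u r₁ (suc s))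
  ladder-walk s even =
    up-walk r₀ (suc s) ℓ∸2
      ++⟨ flat-edge (suc s + ℓ∸2) (odd-suc (s + ℓ∸2) (even+even⇒even s ℓ∸2 even even-ℓ∸2)) ⟩
    down-walk r₁ (suc s) ℓ∸2

  ladder-closing : ∀ s → Even s → u r₁ (suc s) ~ u r₀ (suc s)
  ladder-closing s even = ~-sym (flat-edge (suc s) (odd-suc s even))

  -- Consecutive A-blocks are linked by the jump edge from u r₁ x to u r₀ (x + ℓ).
  aBlocks : ℕ → ℕ → List Vertex
  aBlocks x zero    = []
  aBlocks x (suc a) = up r₀ x ℓ ++ (down r₁ x ℓ ++ aBlocks (x + ℓ) a)

  aBlocks-walk : ∀ a x → Even x → ∀ {L z} →
    Walk G (u r₀ (x + a * ℓ)) L z → Walk G (u r₀ x) (aBlocks x a ++ L) z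
  aBlocks-walk zero x even {L} {z} p = subst (λ d → Walk G (u r₀ d) L z) (+-identityʳ x) p
  aBlocks-walk (suc a) x even {L} {z} p
    rewrite ++-assoc (up r₀ x ℓ) (down r₁ x ℓ ++ aBlocks (x + ℓ) a) L
          | ++-assoc (down r₁ x ℓ) (aBlocks (x + ℓ) a) L
    = up-walk r₀ x ℓ∸1
        ++⟨ flat-edge (x + ℓ∸1) (even+odd⇒odd x ℓ∸1 even odd-ℓ∸1) ⟩
      down-walk r₁ x ℓ∸1
        ++⟨ jump-edge x even ⟩
      aBlocks-walk a (x + ℓ) (even+even⇒even x ℓ even even-ℓ)
        (subst (λ d → Walk G (u r₀ d) L z) (sym (+-assoc x ℓ (a * ℓ))) p)

  -- A B-block at y is entered at u r₀ (y + ℓ) by the jump edge back to u r₁ y;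
  -- its row 0 run ends at the entry column of the next block.
  bBlocks : ℕ → ℕ → List Vertex
  bBlocks y zero    = []
  bBlocks y (suc b) = up r₁ y ℓ+2 ++ (up r₀ (y + suc ℓ) ℓ+2 ++ bBlocks (y + ℓ+2) b)

  bBlocks-walk : ∀ b y → Even y →
    Walk G (u r₀ (y + ℓ)) (u r₀ (y + ℓ) ∷ bBlocks y b) (u r₀ (y + b * ℓ+2 + ℓ))
  bBlocks-walk zero y even
    rewrite +-identityʳ y = [ _ ]
  bBlocks-walk (suc b) y even =
    ~-sym (jump-edge y even) ◅
      up-walk r₁ y (suc ℓ)
        ++⟨ ~-sym (flat-edge (y + suc ℓ) (even+odd⇒odd y (suc ℓ) even (odd-suc ℓ even-ℓ))) ⟩
      up-walk r₀ (y + suc ℓ) (suc ℓ)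
        ++ʷ subst₂ (λ d e → Walk G (u r₀ d) (u r₀ d ∷ bBlocks (y + ℓ+2) b) (u r₀ e))
              (next-entry y ℓ) (cong (_+ ℓ) (+-assoc y ℓ+2 (b * ℓ+2)))
              (bBlocks-walk b (y + ℓ+2) (even+even⇒even y ℓ+2 even even-ℓ+2))
    where
    next-entry : ∀ y l → y + suc (suc l) + l ≡ y + suc l + suc l
    next-entry = solve-∀

  mid : ℕ → ℕ → ℕ
  mid s a = s + ℓ + a * ℓ

  top : ℕ → ℕ → ℕ → ℕ
  top s a b = mid s a + b * ℓ+2

  Fills : ℕ → ℕ → Set
  Fills a b = ℓ∸1 + (a * ℓ + (suc ℓ + b * ℓ+2)) ≡ n

  -- When Fills a b, top + ℓ ≡ s + n, so the jump edge at the end of the first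
  -- run wraps around to column s + ℓ, just after the ladder.
  complement : ℕ → ℕ → ℕ → List Vertex
  complement s a b =
    up r₁ (top s a b) (suc ℓ) ++
    (aBlocks (s + ℓ) a ++ (up r₀ (mid s a) (suc ℓ) ++ bBlocks (mid s a) b))

  top+ℓ≡s+n : ∀ s a b → Fills a b → top s a b + ℓ ≡ s + n
  top+ℓ≡s+n s a b fills = trans (columns s ℓ∸1 (a * ℓ) (b * ℓ+2)) (cong (s +_) fills)
    where
    columns : ∀ s l A B → s + suc l + A + B + suc l ≡ s + (l + (A + (suc (suc l) + B)))
    columns = solve-∀

  even-mid : ∀ s a → Even s → Even (mid s a)
  even-mid s a even =
    even+even⇒even (s + ℓ) (a * ℓ) (even+even⇒even s ℓ even even-ℓ) (m*even⇒even a ℓ even-ℓ)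

  even-top : ∀ s a b → Even s → Even (top s a b)
  even-top s a b even =
    even+even⇒even (mid s a) (b * ℓ+2) (even-mid s a even) (m*even⇒even b ℓ+2 even-ℓ+2)

  complement-walk : ∀ s a b → Even s → Fills a b →
    Walk G (u r₁ (top s a b)) (complement s a b) (u r₀ (top s a b + ℓ))
  complement-walk s a b even fills =
    up-walk r₁ (top s a b) ℓ
      ++⟨ wrap ⟩
    aBlocks-walk a (s + ℓ) (even+even⇒even s ℓ even even-ℓ)
      (up-walk r₀ (mid s a) ℓ ++ʷ bBlocks-walk b (mid s a) (even-mid s a even))
    where
    wrap : u r₁ (top s a b + ℓ) ~ u r₀ (s + ℓ)
    wrap = subst (u r₁ (top s a b + ℓ) ~_) (trans (cong (u r₀) wrap-column) (u-+n r₀ (s + ℓ)))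
      (jump-edge (top s a b + ℓ) (even+even⇒even (top s a b) ℓ (even-top s a b even) even-ℓ))
      where
      wrap-column : top s a b + ℓ + ℓ ≡ s + ℓ + n
      wrap-column = trans (cong (_+ ℓ) (top+ℓ≡s+n s a b fills)) (swap-last s n ℓ)
        where
        swap-last : ∀ x y z → x + y + z ≡ x + z + y
        swap-last = solve-∀

  complement-closing : ∀ s a b → Even s → u r₀ (top s a b + ℓ) ~ u r₁ (top s a b)
  complement-closing s a b even = ~-sym (jump-edge (top s a b) (even-top s a b even))

  private
    module ++-Solver = Algebra.Solver.CommutativeMonoid (++-commutativeMonoid {A = Vertex})
    open ++-Solver using (_⊕_; _⊜_)

  aBlocks↭ : ∀ a x → aBlocks x a ↭ up r₀ x (a * ℓ) ++ up r₁ x (a * ℓ)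
  aBlocks↭ zero    x = ↭-refl
  aBlocks↭ (suc a) x = begin
    U₀ ++ (D₁ ++ aBlocks (x + ℓ) a)   ↭⟨ ++⁺ˡ U₀ (++⁺ (down↭up r₁ x ℓ) (aBlocks↭ a (x + ℓ))) ⟩
    U₀ ++ (U₁ ++ (R₀ ++ R₁))          ↭⟨ regroup U₀ U₁ R₀ R₁ ⟩
    (U₀ ++ R₀) ++ (U₁ ++ R₁)          ≡⟨ cong₂ _++_ (up-++ r₀ x ℓ (a * ℓ)) (up-++ r₁ x ℓ (a * ℓ)) ⟨
    up r₀ x (suc a * ℓ) ++ up r₁ x (suc a * ℓ) ∎
    where
    open PermutationReasoning
    U₀ = up r₀ x ℓ
    U₁ = up r₁ x ℓ
    D₁ = down r₁ x ℓ
    R₀ = up r₀ (x + ℓ) (a * ℓ)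
    R₁ = up r₁ (x + ℓ) (a * ℓ)
    regroup : ∀ (p q v w : List Vertex) → p ++ (q ++ (v ++ w)) ↭ (p ++ v) ++ (q ++ w)
    regroup = ++-Solver.solve 4 (λ p q v w → p ⊕ (q ⊕ (v ⊕ w)) ⊜ (p ⊕ v) ⊕ (q ⊕ w)) ↭-refl

  bBlocks↭ : ∀ b y → bBlocks y b ↭ up r₀ (y + suc ℓ) (b * ℓ+2) ++ up r₁ y (b * ℓ+2)
  bBlocks↭ zero    y = ↭-refl
  bBlocks↭ (suc b) y = begin
    U₁ ++ (U₀ ++ bBlocks (y + ℓ+2) b)  ↭⟨ ++⁺ˡ U₁ (++⁺ˡ U₀ (bBlocks↭ b (y + ℓ+2))) ⟩
    U₁ ++ (U₀ ++ (R₀ ++ R₁))           ↭⟨ regroup U₁ U₀ R₀ R₁ ⟩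
    (U₀ ++ R₀) ++ (U₁ ++ R₁)           ≡⟨ cong₂ _++_ row₀ (up-++ r₁ y ℓ+2 (b * ℓ+2)) ⟨
    up r₀ (y + suc ℓ) (suc b * ℓ+2) ++ up r₁ y (suc b * ℓ+2) ∎
    where
    open PermutationReasoning
    U₀ = up r₀ (y + suc ℓ) ℓ+2
    U₁ = up r₁ y ℓ+2
    R₀ = up r₀ (y + ℓ+2 + suc ℓ) (b * ℓ+2)
    R₁ = up r₁ (y + ℓ+2) (b * ℓ+2)
    row₀ : up r₀ (y + suc ℓ) (suc b * ℓ+2) ≡ U₀ ++ R₀
    row₀ = trans (up-++ r₀ (y + suc ℓ) ℓ+2 (b * ℓ+2))
      (cong (λ c → U₀ ++ up r₀ c (b * ℓ+2)) (swap-last y (suc ℓ) ℓ+2))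
      where
      swap-last : ∀ x y z → x + y + z ≡ x + z + y
      swap-last = solve-∀
    regroup : ∀ (p q v w : List Vertex) → p ++ (q ++ (v ++ w)) ↭ (q ++ v) ++ (p ++ w)
    regroup = ++-Solver.solve 4 (λ p q v w → p ⊕ (q ⊕ (v ⊕ w)) ⊜ (q ⊕ v) ⊕ (p ⊕ w)) ↭-refl

  ladder++complement↭vertices : ∀ s a b → Fills a b → ladder s ++ complement s a b ↭ vertices
  ladder++complement↭vertices s a b fills = begin
    (L₀ ++ D₁) ++ (T ++ (aBlocks (s + ℓ) a ++ (M₀ ++ bBlocks (mid s a) b)))
      ↭⟨ ++⁺ (++⁺ˡ L₀ (down↭up r₁ (suc s) ℓ∸1))
             (++⁺ˡ T (++⁺ (aBlocks↭ a (s + ℓ)) (++⁺ˡ M₀ (bBlocks↭ b (mid s a))))) ⟩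
    (L₀ ++ L₁) ++ (T ++ ((A₀ ++ A₁) ++ (M₀ ++ (B₀ ++ B₁))))
      ↭⟨ regroup L₀ L₁ T A₀ A₁ M₀ B₀ B₁ ⟩
    (L₀ ++ (A₀ ++ (M₀ ++ B₀))) ++ (L₁ ++ (A₁ ++ (B₁ ++ T)))
      ≡⟨ cong₂ _++_ row₀ row₁ ⟨
    up r₀ (suc s) n ++ up r₁ (suc s) n
      ↭⟨ ++⁺ (up↭row r₀ (suc s)) (up↭row r₁ (suc s)) ⟩
    vertices ∎
    where
    open PermutationReasoning
    L₀ = up r₀ (suc s) ℓ∸1
    L₁ = up r₁ (suc s) ℓ∸1
    D₁ = down r₁ (suc s) ℓ∸1
    T  = up r₁ (top s a b) (suc ℓ)
    A₀ = up r₀ (s + ℓ) (a * ℓ)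
    A₁ = up r₁ (s + ℓ) (a * ℓ)
    M₀ = up r₀ (mid s a) (suc ℓ)
    B₀ = up r₀ (mid s a + suc ℓ) (b * ℓ+2)
    B₁ = up r₁ (mid s a) (b * ℓ+2)
    ladder-end : suc s + ℓ∸1 ≡ s + ℓ
    ladder-end = sym (+-suc s ℓ∸1)
    row₀ : up r₀ (suc s) n ≡ L₀ ++ (A₀ ++ (M₀ ++ B₀))
    row₀ = trans (cong (up r₀ (suc s)) (sym fills))
      (up-++₄ r₀ (suc s) ℓ∸1 (a * ℓ) (suc ℓ) (b * ℓ+2) ladder-end refl refl)
    row₁ : up r₁ (suc s) n ≡ L₁ ++ (A₁ ++ (B₁ ++ T))
    fills′ : ℓ∸1 + (a * ℓ + (b * ℓ+2 + suc ℓ)) ≡ n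
    fills′ = trans (cong (λ k → ℓ∸1 + (a * ℓ + k)) (+-comm (b * ℓ+2) (suc ℓ))) fills
    row₁ = trans (cong (up r₁ (suc s)) (sym fills′))
      (up-++₄ r₁ (suc s) ℓ∸1 (a * ℓ) (b * ℓ+2) (suc ℓ) ladder-end refl refl)
    regroup : ∀ (l₀ l₁ t₁ a₀ a₁ m₀ b₀ b₁ : List Vertex) →
      (l₀ ++ l₁) ++ (t₁ ++ ((a₀ ++ a₁) ++ (m₀ ++ (b₀ ++ b₁)))) ↭
      (l₀ ++ (a₀ ++ (m₀ ++ b₀))) ++ (l₁ ++ (a₁ ++ (b₁ ++ t₁)))
    regroup = ++-Solver.solve 8 (λ l₀ l₁ t₁ a₀ a₁ m₀ b₀ b₁ →
      (l₀ ⊕ l₁) ⊕ (t₁ ⊕ ((a₀ ⊕ a₁) ⊕ (m₀ ⊕ (b₀ ⊕ b₁)))) ⊜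
      (l₀ ⊕ (a₀ ⊕ (m₀ ⊕ b₀))) ⊕ (l₁ ⊕ (a₁ ⊕ (b₁ ⊕ t₁)))) ↭-refl

  ladder-TwoCycleFactor : ∀ s a b → Even s → Fills a b → TwoCycleFactor G (ladder s) (complement s a b)
  ladder-TwoCycleFactor s a b even fills = partition⇒TwoCycleFactor
    (ladder-walk s even) (ladder-closing s even) (s≤s (s≤s (s≤s z≤n)))
    (complement-walk s a b even fills) (complement-closing s a b even) (s≤s (s≤s (s≤s z≤n)))
    (ladder++complement↭vertices s a b fills) vertices-unique ∈-vertices

  ∈-ladder⁻ : ∀ s {r x} → (r , x) ∈ ladder s → Σ ℕ λ e → e < ℓ∸1 × toℕ x ≡ (suc s + e) % n
  ∈-ladder⁻ s x∈ with ∈-++⁻ (up r₀ (suc s) ℓ∸1) x∈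
  ... | inj₁ x∈₀ = ∈-up⇒column r₀ (suc s) ℓ∸1 x∈₀
  ... | inj₂ x∈₁ = ∈-up⇒column r₁ (suc s) ℓ∸1 (∈-resp-↭ (down↭up r₁ (suc s) ℓ∸1) x∈₁)

  ∈-ladder⁺ : ∀ s {r x e} → e < ℓ∸1 → (suc s + e) % n ≡ toℕ x → (r , x) ∈ ladder s
  ∈-ladder⁺ s {fz} {x} e<ℓ∸1 col =
    subst (_∈ ladder s) (u-≡ r₀ _ x col) (∈-++⁺ˡ (∈-up⁺ r₀ (suc s) ℓ∸1 e<ℓ∸1))
  ∈-ladder⁺ s {fs fz} {x} e<ℓ∸1 col =
    subst (_∈ ladder s) (u-≡ r₁ _ x col) (∈-++⁺ʳ (up r₀ (suc s) ℓ∸1)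
      (∈-resp-↭ (↭-sym (down↭up r₁ (suc s) ℓ∸1)) (∈-up⁺ r₁ (suc s) ℓ∸1 e<ℓ∸1)))

  Fills-from-bound : ∀ m → n ≡ m + m → t * t + 5 * t + 5 < m → Σ ℕ λ a → Σ ℕ λ b → Fills a b
  Fills-from-bound m n≡m+m bound
    with d , Q+d≡m ← m≤n⇒∃[o]m+o≡n bound
    with a , b , combination ← consecutive-combination (suc t) d
    = a , b , (begin
      ℓ∸1 + (a * ℓ + (suc ℓ + b * ℓ+2))                  ≡⟨ expand-columns t a b ⟩
      (8 + 4 * t) + 2 * (a * (2 + t) + b * (3 + t))      ≡⟨ cong (λ c → (8 + 4 * t) + 2 * c) combination ⟩
      (8 + 4 * t) + 2 * (d + (2 + t) * (1 + t))          ≡⟨ expand-m+m t d ⟩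
      Q + d + (Q + d)                                    ≡⟨ cong₂ _+_ Q+d≡m Q+d≡m ⟩
      m + m                                              ≡⟨ n≡m+m ⟨
      n                                                  ∎)
    where
    open ≡-Reasoning
    Q = suc (t * t + 5 * t + 5)
    expand-columns : ∀ t a b → 3 + (t + t) + (a * (4 + (t + t)) + (5 + (t + t) + b * (6 + (t + t))))
                      ≡ (8 + 4 * t) + 2 * (a * (2 + t) + b * (3 + t))
    expand-columns = solve-∀
    expand-m+m : ∀ t d → (8 + 4 * t) + 2 * (d + (2 + t) * (1 + t))
                     ≡ 1 + (t * t + 5 * t + 5) + d + (1 + (t * t + 5 * t + 5) + d)
    expand-m+m = solve-∀

  module _ {a b : ℕ} (fills : Fills a b) where

    ℓ∸1+ℓ+1≤n : ℓ∸1 + suc ℓ ≤ n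
    ℓ∸1+ℓ+1≤n = subst (ℓ∸1 + suc ℓ ≤_) fills
      (+-monoʳ-≤ ℓ∸1 (≤-trans (m≤m+n (suc ℓ) (b * ℓ+2)) (m≤n+m _ (a * ℓ))))

    3≤n : 3 ≤ n
    3≤n = ≤-trans (s≤s (s≤s (s≤s z≤n))) ℓ∸1+ℓ+1≤n

    offsets<n : ∀ {e f} → e ≤ ℓ∸2 → f ≤ ℓ∸2 → e + f < n
    offsets<n e≤ f≤ = <-≤-trans (+-mono-≤-< e≤ (s≤s f≤))
      (≤-trans (+-monoʳ-≤ ℓ∸2 (s≤s (m≤n+m ℓ∸2 2))) (≤-trans (m≤n+m _ 1) ℓ∸1+ℓ+1≤n))

    ∈-complement : ∀ s {v} → Even s → ¬ (v ∈ ladder s) → v ∈ complement s a b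
    ∈-complement s even v∉ with TwoCycleFactor.spanning (ladder-TwoCycleFactor s a b even fills) _
    ... | inj₁ v∈ = ⊥-elim (v∉ v∈)
    ... | inj₂ v∈ = v∈

    ladders-overlap : ∀ {s₁ s₂ j r x} → j < n → (suc s₂ + ℓ∸2) % n ≡ (suc s₁ + j) % n →
      (r , x) ∈ ladder s₁ → (r , x) ∈ ladder s₂ → Σ ℕ λ f → f ≤ j × toℕ x ≡ (suc s₁ + f) % n
    ladders-overlap {s₁} {s₂} {j} j<n ends x∈₁ x∈₂
      with f₁ , f₁<ℓ∸1 , col₁ ← ∈-ladder⁻ s₁ x∈₁
         | f₂ , f₂<ℓ∸1 , col₂ ← ∈-ladder⁻ s₂ x∈₂
      with g , f₂+g≡ℓ∸2 ← m≤n⇒∃[o]m+o≡n (≤-pred f₂<ℓ∸1)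
      = f₁ , subst (f₁ ≤_) f₁+g≡j (m≤m+n f₁ g) , col₁
      where
      open ≡-Reasoning
      f₁+g≡j : f₁ + g ≡ j
      f₁+g≡j = [m+o]%n≡[m+p]%n⇒o≡p (suc s₁)
        (offsets<n (≤-pred f₁<ℓ∸1) (subst (g ≤_) f₂+g≡ℓ∸2 (m≤n+m g f₂))) j<n (begin
        (suc s₁ + (f₁ + g)) % n      ≡⟨ cong (_% n) (+-assoc (suc s₁) f₁ g) ⟨
        (suc s₁ + f₁ + g) % n        ≡⟨ [m%n+o]%n≡[m+o]%n (suc s₁ + f₁) g ⟨
        ((suc s₁ + f₁) % n + g) % n  ≡⟨ cong (λ c → (c + g) % n) (trans (sym col₁) col₂) ⟩
        ((suc s₂ + f₂) % n + g) % n  ≡⟨ [m%n+o]%n≡[m+o]%n (suc s₂ + f₂) g ⟩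
        (suc s₂ + f₂ + g) % n        ≡⟨ cong (_% n) (+-assoc (suc s₂) f₂ g) ⟩
        (suc s₂ + (f₂ + g)) % n      ≡⟨ cong (λ c → (suc s₂ + c) % n) f₂+g≡ℓ∸2 ⟩
        (suc s₂ + ℓ∸2) % n           ≡⟨ ends ⟩
        (suc s₁ + j) % n             ∎)

    Separated : Fin 2 → Fin n → Fin n → Set
    Separated r x y = Σ ℕ λ s → Even s × (r , x) ∈ ladder s × ¬ ((r , y) ∈ ladder s)

    separate-by-two : ∀ {r x y} s₁ s₂ → Even s₁ → Even s₂ →
      (r , x) ∈ ladder s₁ → (r , x) ∈ ladder s₂ →
      ((r , y) ∈ ladder s₁ → (r , y) ∈ ladder s₂ → ⊥) → Separated r x y
    separate-by-two {r} {y = y} s₁ s₂ even₁ even₂ x∈₁ x∈₂ not-both with (r , y) ∈? ladder s₁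
      where open DecMembership (≡-dec Fin._≟_ Fin._≟_)
    ... | no  y∉₁ = s₁ , even₁ , x∈₁ , y∉₁
    ... | yes y∈₁ = s₂ , even₂ , x∈₂ , not-both y∈₁

    -- For odd x: the ladder whose first column is x, and the one whose last column is x.
    separate-odd : ∀ {r x y} → x ≢ y → Odd (toℕ x) → Separated r x y
    separate-odd {r} {x} {y} x≢y odd
      with s₁ , suc-s₁≡x , even₁ ← odd⇒suc-even (toℕ x) odd
      = separate-by-two s₁ s₂ even₁ even₂
          (∈-ladder⁺ s₁ (s≤s z≤n) first₁) (∈-ladder⁺ s₂ ≤-refl last₂) not-both
      where
      s₂ = toℕ x + n ∸ ℓ∸1
      s₂+ℓ∸1 : s₂ + ℓ∸1 ≡ toℕ x + n
      s₂+ℓ∸1 = m∸n+n≡m (≤-trans (≤-trans (m≤m+n ℓ∸1 _) ℓ∸1+ℓ+1≤n) (m≤n+m n (toℕ x)))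
      even₂ : Even s₂
      even₂ = odd-cancelʳ s₂ ℓ∸1 (subst Odd (sym s₂+ℓ∸1) (odd+even⇒odd (toℕ x) n odd n-even)) odd-ℓ∸1
      first₁ : (suc s₁ + 0) % n ≡ toℕ x
      first₁ = trans (cong (_% n) (trans (+-identityʳ (suc s₁)) suc-s₁≡x)) (m<n⇒m%n≡m (toℕ<n x))
      last₂ : (suc s₂ + ℓ∸2) % n ≡ toℕ x
      last₂ = trans (cong (_% n) (trans (sym (+-suc s₂ ℓ∸2)) s₂+ℓ∸1)) (toℕ+n%n x)
      not-both : (r , y) ∈ ladder s₁ → (r , y) ∈ ladder s₂ → ⊥
      not-both y∈₁ y∈₂
        with f , f≤0 , col ← ladders-overlap (≤-trans (s≤s z≤n) 3≤n) (trans last₂ (sym first₁)) y∈₁ y∈₂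
        rewrite n≤0⇒n≡0 f≤0 = x≢y (toℕ-injective (trans (sym first₁) (sym col)))

    -- For even x and y: the ladders whose second and second-to-last columns are x.
    separate-even : ∀ {r x y} → x ≢ y → Even (toℕ x) → Even (toℕ y) → Separated r x y
    separate-even {r} {x} {y} x≢y even-x even-y =
      separate-by-two s₁ s₂ even₁ even₂
        (∈-ladder⁺ s₁ (s≤s (s≤s z≤n)) second₁) (∈-ladder⁺ s₂ (n≤1+n ℓ∸2) last∸1₂) not-both
      where
      x+n≥ : ∀ {k} → k ≤ n → k ≤ toℕ x + n
      x+n≥ k≤n = ≤-trans k≤n (m≤n+m n (toℕ x))
      even-x+n : Even (toℕ x + n)
      even-x+n = even+even⇒even (toℕ x) n even-x n-even
      s₁ = toℕ x + n ∸ 2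
      s₁+2 : s₁ + 2 ≡ toℕ x + n
      s₁+2 = m∸n+n≡m (x+n≥ (≤-trans (n≤1+n 2) 3≤n))
      even₁ : Even s₁
      even₁ = even-cancelʳ s₁ 2 (subst Even (sym s₁+2) even-x+n) refl
      s₂ = toℕ x + n ∸ ℓ∸2
      s₂+ℓ∸2 : s₂ + ℓ∸2 ≡ toℕ x + n
      s₂+ℓ∸2 = m∸n+n≡m (x+n≥ (≤-trans (≤-trans (n≤1+n ℓ∸2) (m≤m+n ℓ∸1 _)) ℓ∸1+ℓ+1≤n))
      even₂ : Even s₂
      even₂ = even-cancelʳ s₂ ℓ∸2 (subst Even (sym s₂+ℓ∸2) even-x+n) even-ℓ∸2
      second₁ : (suc s₁ + 1) % n ≡ toℕ x
      second₁ = trans (cong (_% n) (trans (sym (+-suc s₁ 1)) s₁+2)) (toℕ+n%n x)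
      last∸1₂ : (suc s₂ + suc (t + t)) % n ≡ toℕ x
      last∸1₂ = trans (cong (_% n) (trans (sym (+-suc s₂ (suc (t + t)))) s₂+ℓ∸2)) (toℕ+n%n x)
      wrong-parity : ∀ f → Even f → toℕ y ≡ (suc s₁ + f) % n → ⊥
      wrong-parity f even-f col
        with () ← trans (sym even-y) (trans (cong (_% 2) col)
                    (trans ([m%n]%2≡m%2 (suc s₁ + f)) (odd+even⇒odd (suc s₁) f (odd-suc s₁ even₁) even-f)))
      excluded : ∀ f → f ≤ 2 → toℕ y ≡ (suc s₁ + f) % n → ⊥
      excluded 0 _ col = wrong-parity 0 refl col
      excluded 1 _ col = x≢y (toℕ-injective (trans (sym second₁) (sym col)))
      excluded 2 _ col = wrong-parity 2 refl col
      excluded (suc (suc (suc _))) (s≤s (s≤s ()))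
      ends : (suc s₂ + ℓ∸2) % n ≡ (suc s₁ + 2) % n
      ends = cong (λ c → suc c % n) (trans s₂+ℓ∸2 (sym s₁+2))
      not-both : (r , y) ∈ ladder s₁ → (r , y) ∈ ladder s₂ → ⊥
      not-both y∈₁ y∈₂ with f , f≤2 , col ← ladders-overlap 3≤n ends y∈₁ y∈₂ = excluded f f≤2 col

    separate : ∀ {r x y} → x ≢ y → Separated r x y ⊎ Separated r y x
    separate {x = x} {y} x≢y with even⊎odd (toℕ x) | even⊎odd (toℕ y)
    ... | inj₂ odd-x  | _          = inj₁ (separate-odd x≢y odd-x)
    ... | inj₁ _      | inj₂ odd-y = inj₂ (separate-odd (x≢y ∘ sym) odd-y)
    ... | inj₁ even-x | inj₁ even-y = inj₁ (separate-even x≢y even-x even-y)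

    Separated⇒Separating : ∀ {r x y} → Separated r x y → Separating (r , x) (r , y)
    Separated⇒Separating (s , even , x∈ , y∉) =
      ladder s , complement s a b , ladder-TwoCycleFactor s a b even fills , x∈ , ∈-complement s even y∉

    same-row : ∀ r {x y} → (r , x) ≢ (r , y) → Separating (r , x) (r , y)
    same-row r v≢w with separate (v≢w ∘ cong (r ,_))
    ... | inj₁ sep = Separated⇒Separating sep
    ... | inj₂ sep = Separating-swap (Separated⇒Separating sep)

    different-rows : ∀ x y → Separating (r₀ , x) (r₁ , y)
    different-rows x y = up r₀ 0 n , up r₁ 0 n , rows-TwoCycleFactor 3≤n , ∈-row r₀ x , ∈-row r₁ y

    twoSpanningCyclable : TwoSpanningCyclable G
    twoSpanningCyclable (fz    , x) (fz    , y) v≢w = same-row r₀ v≢w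
    twoSpanningCyclable (fs fz , x) (fs fz , y) v≢w = same-row r₁ v≢w
    twoSpanningCyclable (fz    , x) (fs fz , y) _   = different-rows x y
    twoSpanningCyclable (fs fz , x) (fz    , y) _   = Separating-swap (different-rows y x)

square-bound : ∀ t {n m} → n ≡ m + m →
  ((4 + (t + t)) * (4 + (t + t)) + 2 * (4 + (t + t))) ∸ 4 < 2 * n → t * t + 5 * t + 5 < m
square-bound t {m = m} refl bound = *-cancelˡ-< 4 _ _ (subst₂ _<_ lhs (rhs m) bound)
  where
  lhs : ((4 + (t + t)) * (4 + (t + t)) + 2 * (4 + (t + t))) ∸ 4 ≡ 4 * (t * t + 5 * t + 5)
  lhs = trans (cong (_∸ 4) (expand t)) (m+n∸n≡m _ 4)
    where
    expand : ∀ t → (4 + (t + t)) * (4 + (t + t)) + 2 * (4 + (t + t)) ≡ 4 * (t * t + 5 * t + 5) + 4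
    expand = solve-∀
  rhs : ∀ m → 2 * (m + m) ≡ 4 * m
  rhs = solve-∀

corollary3p4 : (ℓ n : ℕ) .{{_ : NonZero n}} →
    ℓ % 2 ≡ 0 → 2 < ℓ → n % 2 ≡ 0 → (ℓ * ℓ + 2 * ℓ) ∸ 4 < 2 * n →
    TwoSpanningCyclable (HTG 2 n ℓ)
corollary3p4 ℓ n ℓ-even 2<ℓ n-even bound
  with t , refl ← even⇒≡4+double ℓ ℓ-even 2<ℓ
  with m , n≡m+m ← even⇒double n n-even
  with a , b , fills ← Ladder.Fills-from-bound n-even t m n≡m+m (square-bound t n≡m+m bound)
  = Ladder.twoSpanningCyclable n-even t {a} {b} fills
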